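{- Let $n$ be a positive integer. For $l\in[2]$ and $j\in[2n]$ define $X^l_j\subseteq\mathbb{Z}^n$ by $$X^l_j=\begin{cases}\{x\in\mathbb{Z}^n:\ \sum_i x_i\equiv l \pmod 4,\ \sum_i ix_i\equiv j\pmod n\} & \text{if } j\le n,\\ \{x\in\mathbb{Z}^n:\ \sum_i x_i\equiv l+2 \pmod 4,\ \sum_i ix_i\equiv j\pmod n\} & \text{if } j> n.\end{cases}$$ Then the family $\{X^l_j\}_{l\in[2],j\in[2n]}$ is an $(n,n)$-filling family.
   Context: $[k]=\{1,\dots,k\}$. $\mathbb{Z}^d$ is the graph with edges $\{x,x+e_i\}$; $\Gamma(x)=\{x\pm e_i:i\in[d]\}$. For $m$ a multiple of $n$, a family $\{X^i_j\}_{i\in[\frac{m+n}{n}],j\in[2n]}$ of subsets of $\mathbb{Z}^m$, with $X^i=\bigsqcup_j X^i_j$, is $(m,n)$-filling if the family partitions $\mathbb{Z}^m$ and for each $i\in[\frac{m+n}{n}]$, $j\in[2n]$: if $x\in\mathbb{Z}^m\setminus X^i$ then $|\Gamma(x)\cap X^i_j|=1$, and if $x\in X^i$ then $\Gamma(x)\cap X^i=\emptyset$. -}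

module Defs where

open import Data.Nat as ℕ using (ℕ; suc; NonZero)
open import Data.Integer as ℤ using (ℤ; +_; _+_; _-_; _*_)
open import Data.Integer.Divisibility using (_∣_)
open import Data.Fin as Fin using (Fin; toℕ)
open import Data.Bool using (Bool; true; false)
open import Data.Product using (_×_; ∃; ∃-syntax; _,_)
open import Data.Sum using (_⊎_)
open import Relation.Nullary using (¬_; yes; no)
open import Relation.Binary.PropositionalEquality using (_≡_)

Pt : ℕ → Set
Pt m = Fin m → ℤ

Subset : ℕ → Set₁
Subset m = Pt m → Set

e : ∀ {m} → Fin m → Pt m
e i k with i Fin.≟ k
... | yes _ = + 1
... | no  _ = + 0

-- the neighbour x + e_i (b = true) or x - e_i (b = false).
-- Γ(x) = { nb x i b : i ∈ Fin m, b ∈ Bool }; for m ≥ 1 this indexing is injective.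
nb : ∀ {m} → Pt m → Fin m → Bool → Pt m
nb x i true  k = x k + e i k
nb x i false k = x k - e i k

ExactlyOneNeighbourIn : ∀ {m} → Subset m → Pt m → Set
ExactlyOneNeighbourIn S x =
  ∃[ i ] ∃[ b ] (S (nb x i b) ×
    (∀ i' b' → S (nb x i' b') → (i' ≡ i × b' ≡ b)))

NoNeighbourIn : ∀ {m} → Subset m → Pt m → Set
NoNeighbourIn S x = ∀ i b → ¬ S (nb x i b)

Union : ∀ {m} {J : ℕ} → (Fin J → Subset m) → Subset m
Union {J = J} Xi x = ∃[ j ] Xi j x

-- (m,n)-filling family, with k = (m+n)/n colour classes (k passed explicitly,
-- together with the constraint k * n = m + n, i.e. k = (m+n)/n).
IsFilling : (m n k : ℕ) → (Fin k → Fin (2 ℕ.* n) → Subset m) → Set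
IsFilling m n k X =
  (k ℕ.* n ≡ m ℕ.+ n) ×
  ((x : Pt m) → ∃[ i ] ∃[ j ] (X i j x ×
      (∀ i' j' → X i' j' x → (i' ≡ i × j' ≡ j)))) ×
  ((i : Fin k) (j : Fin (2 ℕ.* n)) (x : Pt m) →
      (¬ Union (X i) x → ExactlyOneNeighbourIn (X i j) x) ×
      (Union (X i) x → NoNeighbourIn (Union (X i)) x))

sumFin : ∀ {n} → (Fin n → ℤ) → ℤ
sumFin {ℕ.zero} f = + 0
sumFin {suc n} f = f Fin.zero + sumFin (λ k → f (Fin.suc k))

sumCoords : ∀ {n} → Pt n → ℤ
sumCoords x = sumFin x

-- Σ_i i·x_i, coordinates indexed i = 1..n (Fin index k ↦ i = toℕ k + 1)
weightedSum : ∀ {n} → Pt n → ℤ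
weightedSum x = sumFin (λ k → + suc (toℕ k) * x k)

_≡_[mod_] : ℤ → ℤ → ℕ → Set
a ≡ b [mod q ] = + q ∣ (a - b)

-- X^l_j for l ∈ [2], j ∈ [2n]; Fin indices l', j' encode l = l'+1, j = j'+1.
Xfam : (n : ℕ) → Fin 2 → Fin (2 ℕ.* n) → Subset n
Xfam n l j x with suc (toℕ j) ℕ.≤? n
... | yes _ = (sumCoords x ≡ + suc (toℕ l) [mod 4 ]) ×
              (weightedSum x ≡ + suc (toℕ j) [mod n ])
... | no  _ = (sumCoords x ≡ + (suc (toℕ l) ℕ.+ 2) [mod 4 ]) ×
              (weightedSum x ≡ + suc (toℕ j) [mod n ])

-- Moving from x to a neighbour x ± eᵢ changes s(x) = Σ xᵢ by ±1 and
-- w(x) = Σ i·xᵢ by ±i.  Hence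
--   * s mod 4 determines l and the half of j, and w mod n then determines j
--     inside that half: the family is a partition;
--   * X^l is a parity class of s, and neighbours have opposite parity, so
--     X^l has no edges;
--   * if x ∉ X^l, exactly one sign σ ∈ {±1} moves s to the residue prescribed
--     by X^l_j, and then exactly one i ∈ [n] solves w + σ·i ≡ j (mod n).

module Submission where

open import Defs
open import Data.Nat using (ℕ; _≥_)
open import Data.Nat as ℕ using (suc; NonZero; _≤_; _<_; z<s)
import Data.Nat.Properties as ℕP
import Data.Nat.Divisibility as ℕD
open import Data.Integer as ℤ using (ℤ; +_; _+_; _-_; _*_; -_; ∣_∣)
import Data.Integer.Properties as ℤP
import Data.Integer.Divisibility.Signed as SD
open import Data.Integer.DivMod using (_%ℕ_; _/ℕ_; n%ℕd<d; a≡a%ℕn+[a/ℕn]*n)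
open import Data.Integer.Tactic.RingSolver using (solve-∀)
open import Data.Fin as Fin using (Fin; zero; suc; toℕ; fromℕ; fromℕ<; _↑ˡ_; _↑ʳ_)
import Data.Fin.Properties as FinP
open import Data.Fin.Properties using (all?)
open import Data.Bool using (Bool; true; false)
import Data.Bool.Properties as BoolP
open import Data.Product using (_×_; Σ; ∃-syntax; _,_; proj₁; proj₂)
open import Data.Sum using (inj₁; inj₂)
open import Function using (_∘_)
open import Relation.Nullary using (Dec; yes; no; ¬_; ¬?; _×-dec_; _⊎-dec_; _→-dec_; contradiction)
open import Relation.Nullary.Decidable using (from-yes; map′)
open import Relation.Binary.PropositionalEquality
open ≡-Reasoning

infix 4 _≋_[mod_]

-- a ≡ b (mod q), wrapped in a record so that a, b and q stay inferable
-- (the unfolded form q ∣ ∣a - b∣ of `_≡_[mod_]` hides them).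
record _≋_[mod_] (a b : ℤ) (q : ℕ) : Set where
  constructor ⟨_⟩
  field divides : + q SD.∣ (a - b)

≋-resp : ∀ {q a b c d} → c - d ≡ a - b → a ≋ b [mod q ] → c ≋ d [mod q ]
≋-resp c-d≡a-b ⟨ q∣a-b ⟩ = ⟨ subst (_ SD.∣_) (sym c-d≡a-b) q∣a-b ⟩

≋-rewrite : ∀ {q a b c d} → a ≡ c → b ≡ d → a ≋ b [mod q ] → c ≋ d [mod q ]
≋-rewrite refl refl a≋b = a≋b

≋-refl : ∀ {q} a → a ≋ a [mod q ]
≋-refl a = ⟨ SD.divides (+ 0) (ℤP.+-inverseʳ a) ⟩

≋-sym : ∀ {q a b} → a ≋ b [mod q ] → b ≋ a [mod q ]
≋-sym {a = a} {b} ⟨ q∣a-b ⟩ = ⟨ subst (_ SD.∣_) (negate a b) (SD.∣m⇒∣-m q∣a-b) ⟩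
  where
  negate : ∀ a b → - (a - b) ≡ b - a
  negate = solve-∀

≋-trans : ∀ {q a b c} → a ≋ b [mod q ] → b ≋ c [mod q ] → a ≋ c [mod q ]
≋-trans {a = a} {b} {c} ⟨ q∣a-b ⟩ ⟨ q∣b-c ⟩ =
  ⟨ subst (_ SD.∣_) (telescope a b c) (SD.∣m∣n⇒∣m+n q∣a-b q∣b-c) ⟩
  where
  telescope : ∀ a b c → (a - b) + (b - c) ≡ a - c
  telescope = solve-∀

≋-+ʳ : ∀ {q a b} k → a ≋ b [mod q ] → a + k ≋ b + k [mod q ]
≋-+ʳ {a = a} {b} k = ≋-resp (difference a b k)
  where
  difference : ∀ a b k → (a + k) - (b + k) ≡ a - b
  difference = solve-∀

≋-+ˡ : ∀ {q a b} k → a ≋ b [mod q ] → k + a ≋ k + b [mod q ]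
≋-+ˡ {a = a} {b} k = ≋-resp (difference a b k)
  where
  difference : ∀ a b k → (k + a) - (k + b) ≡ a - b
  difference = solve-∀

≋-cancelˡ : ∀ {q a b} k → k + a ≋ k + b [mod q ] → a ≋ b [mod q ]
≋-cancelˡ {a = a} {b} k = ≋-resp (difference a b k)
  where
  difference : ∀ a b k → a - b ≡ (k + a) - (k + b)
  difference = solve-∀

≋-*ˡ : ∀ {q a b} c → a ≋ b [mod q ] → c * a ≋ c * b [mod q ]
≋-*ˡ {a = a} {b} c ⟨ q∣a-b ⟩ = ⟨ subst (_ SD.∣_) (distribute c a b) (SD.∣n⇒∣m*n c q∣a-b) ⟩
  where
  distribute : ∀ c a b → c * (a - b) ≡ c * a - c * b
  distribute = solve-∀

≋-dec : ∀ a b q → Dec (a ≋ b [mod q ])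
≋-dec a b q = map′ ⟨_⟩ _≋_[mod_].divides (+ q SD.∣? (a - b))

≋-period : ∀ {q} → + q ≋ + 0 [mod q ]
≋-period {q} = ⟨ SD.divides (+ 1) (trans (ℤP.+-identityʳ (+ q)) (sym (ℤP.*-identityˡ (+ q)))) ⟩

≋-remainder : ∀ q .{{_ : NonZero q}} a → a ≋ + (a %ℕ q) [mod q ]
≋-remainder q a = ⟨ SD.divides (a /ℕ q) (begin
    a - r                  ≡⟨ cong (_- r) (a≡a%ℕn+[a/ℕn]*n a q) ⟩
    (r + (a /ℕ q) * + q) - r ≡⟨ cancel r _ ⟩
    (a /ℕ q) * + q           ∎) ⟩
  where
  r : ℤ
  r = + (a %ℕ q)
  cancel : ∀ r t → (r + t) - r ≡ t
  cancel = solve-∀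

≋-close : ∀ {q} .{{_ : NonZero q}} {a b} → a ≤ b → b < a ℕ.+ q → + a ≋ + b [mod q ] → a ≡ b
≋-close {q} {a} {b} a≤b b<a+q ⟨ q∣a-b ⟩ = ℕP.≤-antisym a≤b (ℕP.m∸n≡0⇒m≤n (vanishes q∣b∸a b∸a<q))
  where
  q∣b∸a : q ℕD.∣ b ℕ.∸ a
  q∣b∸a = subst (q ℕD.∣_) (trans (cong ∣_∣ (ℤP.m-n≡m⊖n a b)) (ℤP.∣⊖∣-≤ a≤b)) (SD.∣⇒∣ᵤ q∣a-b)
  b∸a<q : b ℕ.∸ a < q
  b∸a<q = ℕP.m<n+o⇒m∸n<o b a b<a+q
  vanishes : ∀ {d} → q ℕD.∣ d → d < q → d ≡ 0
  vanishes {ℕ.zero} _ _ = refl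
  vanishes {suc d} q∣d d<q = contradiction q∣d (ℕD.>⇒∤ d<q)

≋-window : ∀ {q} .{{_ : NonZero q}} L {a b} → L < a → a ≤ L ℕ.+ q → L < b → b ≤ L ℕ.+ q →
           + a ≋ + b [mod q ] → a ≡ b
≋-window {q} L {a} {b} L<a a≤L+q L<b b≤L+q a≋b with ℕP.≤-total a b
... | inj₁ a≤b = ≋-close a≤b (ℕP.≤-<-trans b≤L+q (ℕP.+-monoˡ-< q L<a)) a≋b
... | inj₂ b≤a = sym (≋-close b≤a (ℕP.≤-<-trans a≤L+q (ℕP.+-monoˡ-< q L<b)) (≋-sym a≋b))

representative : ∀ m a → Σ (Fin (suc m)) λ r → a ≋ + suc (toℕ r) [mod suc m ]
representative m a with a %ℕ suc m | n%ℕd<d a (suc m) | ≋-remainder (suc m) a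
... | ℕ.zero | _ | a≋0 =
  fromℕ m , subst (λ t → a ≋ + suc t [mod suc m ]) (sym (FinP.toℕ-fromℕ m)) (≋-trans a≋0 (≋-sym ≋-period))
... | suc k | k<m | a≋k =
  fromℕ< (ℕP.<⇒≤ k<m) , subst (λ t → a ≋ + suc t [mod suc m ]) (sym (FinP.toℕ-fromℕ< (ℕP.<⇒≤ k<m))) a≋k

representative-unique : ∀ {m} (r r' : Fin (suc m)) →
                        + suc (toℕ r) ≋ + suc (toℕ r') [mod suc m ] → r ≡ r'
representative-unique r r' r≋r' =
  FinP.toℕ-injective (ℕP.suc-injective (≋-window 0 z<s (FinP.toℕ<n r) z<s (FinP.toℕ<n r') r≋r'))

-- For a unit σ (σ² = 1) the congruence w + σ·i ≡ d (mod q) has exactly one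
-- solution i ∈ {1, …, q}, namely the representative of σ·(d - w).
unique-solution : ∀ m σ → σ * σ ≡ + 1 → ∀ w d →
  Σ (Fin (suc m)) λ i → (w + σ * + suc (toℕ i) ≋ d [mod suc m ]) ×
                        (∀ i' → w + σ * + suc (toℕ i') ≋ d [mod suc m ] → i' ≡ i)
unique-solution m σ σ²≡1 w d = r , solves , only
  where
  r : Fin (suc m)
  r = proj₁ (representative m (σ * (d - w)))

  involution : ∀ a → σ * (σ * a) ≡ a
  involution a = begin
    σ * (σ * a) ≡⟨ ℤP.*-assoc σ σ a ⟨
    σ * σ * a   ≡⟨ cong (_* a) σ²≡1 ⟩
    + 1 * a     ≡⟨ ℤP.*-identityˡ a ⟩
    a           ∎

  back : ∀ w d → w + (d - w) ≡ d
  back = solve-∀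

  solves : w + σ * + suc (toℕ r) ≋ d [mod suc m ]
  solves = ≋-rewrite refl (trans (cong (_+_ w) (involution (d - w))) (back w d))
    (≋-+ˡ w (≋-*ˡ σ (≋-sym (proj₂ (representative m (σ * (d - w)))))))

  only : ∀ i' → w + σ * + suc (toℕ i') ≋ d [mod suc m ] → i' ≡ r
  only i' solves' = representative-unique i' r
    (≋-rewrite (involution _) (involution _) (≋-*ˡ σ (≋-cancelˡ w (≋-trans solves' (≋-sym solves)))))

sumFin-ext : ∀ {n} {f g : Fin n → ℤ} → (∀ k → f k ≡ g k) → sumFin f ≡ sumFin g
sumFin-ext {ℕ.zero} f≗g = refl
sumFin-ext {suc n} f≗g = cong₂ _+_ (f≗g zero) (sumFin-ext (f≗g ∘ suc))

sumFin-zero : ∀ {n} → sumFin {n} (λ _ → + 0) ≡ + 0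
sumFin-zero {ℕ.zero} = refl
sumFin-zero {suc n} = trans (ℤP.+-identityˡ _) (sumFin-zero {n})

sumFin-+ : ∀ {n} (f g : Fin n → ℤ) → sumFin (λ k → f k + g k) ≡ sumFin f + sumFin g
sumFin-+ {ℕ.zero} f g = refl
sumFin-+ {suc n} f g = begin
  (f zero + g zero) + sumFin (λ k → f (suc k) + g (suc k))
    ≡⟨ cong (_+_ (f zero + g zero)) (sumFin-+ (f ∘ suc) (g ∘ suc)) ⟩
  (f zero + g zero) + (sumFin (f ∘ suc) + sumFin (g ∘ suc))
    ≡⟨ interchange (f zero) (g zero) _ _ ⟩
  (f zero + sumFin (f ∘ suc)) + (g zero + sumFin (g ∘ suc)) ∎
  where
  interchange : ∀ a b c d → (a + b) + (c + d) ≡ (a + c) + (b + d)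
  interchange = solve-∀

e-same : ∀ {n} (i : Fin n) → e i i ≡ + 1
e-same i with i Fin.≟ i
... | yes _ = refl
... | no i≢i = contradiction refl i≢i

e-apart : ∀ {n} {i k : Fin n} → ¬ i ≡ k → e i k ≡ + 0
e-apart {i = i} {k} i≢k with i Fin.≟ k
... | yes i≡k = contradiction i≡k i≢k
... | no _ = refl

e-suc : ∀ {n} (i k : Fin n) → e (suc i) (suc k) ≡ e i k
e-suc i k = by-cases (i Fin.≟ k)
  where
  by-cases : Dec (i ≡ k) → e (suc i) (suc k) ≡ e i k
  by-cases (yes refl) = trans (e-same (suc i)) (sym (e-same i))
  by-cases (no i≢k) = trans (e-apart (i≢k ∘ FinP.suc-injective)) (sym (e-apart i≢k))

sumFin-sift : ∀ {n} (c : Fin n → ℤ) (i : Fin n) → sumFin (λ k → c k * e i k) ≡ c i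
sumFin-sift {suc n} c zero = begin
  c zero * + 1 + sumFin (λ k → c (suc k) * + 0)
    ≡⟨ cong₂ _+_ (ℤP.*-identityʳ (c zero)) (trans (sumFin-ext (ℤP.*-zeroʳ ∘ c ∘ suc)) (sumFin-zero {n})) ⟩
  c zero + + 0
    ≡⟨ ℤP.+-identityʳ (c zero) ⟩
  c zero ∎
sumFin-sift c (suc i) = begin
  c zero * + 0 + sumFin (λ k → c (suc k) * e (suc i) (suc k))
    ≡⟨ cong₂ _+_ (ℤP.*-zeroʳ (c zero)) (sumFin-ext (λ k → cong (c (suc k) *_) (e-suc i k))) ⟩
  + 0 + sumFin (λ k → c (suc k) * e i k)
    ≡⟨ ℤP.+-identityˡ _ ⟩
  sumFin (λ k → c (suc k) * e i k)
    ≡⟨ sumFin-sift (c ∘ suc) i ⟩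
  c (suc i) ∎

sgn : Bool → ℤ
sgn true = + 1
sgn false = - + 1

sgn² : ∀ b → sgn b * sgn b ≡ + 1
sgn² true = refl
sgn² false = refl

nb-coord : ∀ {n} (x : Pt n) i b k → nb x i b k ≡ x k + sgn b * e i k
nb-coord x i true k = cong (_+_ (x k)) (sym (ℤP.*-identityˡ (e i k)))
nb-coord x i false k = cong (_+_ (x k)) (sym (ℤP.-1*i≡-i (e i k)))

linear-nb : ∀ {n} (a : Fin n → ℤ) (x : Pt n) i b →
            sumFin (λ k → a k * nb x i b k) ≡ sumFin (λ k → a k * x k) + sgn b * a i
linear-nb a x i b = begin
  sumFin (λ k → a k * nb x i b k)
    ≡⟨ sumFin-ext (λ k → trans (cong (a k *_) (nb-coord x i b k)) (expand (a k) (x k) (sgn b) (e i k))) ⟩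
  sumFin (λ k → a k * x k + (sgn b * a k) * e i k)
    ≡⟨ sumFin-+ (λ k → a k * x k) (λ k → (sgn b * a k) * e i k) ⟩
  sumFin (λ k → a k * x k) + sumFin (λ k → (sgn b * a k) * e i k)
    ≡⟨ cong (_+_ (sumFin (λ k → a k * x k))) (sumFin-sift (λ k → sgn b * a k) i) ⟩
  sumFin (λ k → a k * x k) + sgn b * a i ∎
  where
  expand : ∀ a y σ ε → a * (y + σ * ε) ≡ a * y + (σ * a) * ε
  expand = solve-∀

sumCoords-nb : ∀ {n} (x : Pt n) i b → sumCoords (nb x i b) ≡ sumCoords x + sgn b
sumCoords-nb x i b = begin
  sumFin (nb x i b)                       ≡⟨ sumFin-ext (λ k → sym (ℤP.*-identityˡ (nb x i b k))) ⟩
  sumFin (λ k → + 1 * nb x i b k)         ≡⟨ linear-nb (λ _ → + 1) x i b ⟩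
  sumFin (λ k → + 1 * x k) + sgn b * + 1  ≡⟨ cong₂ _+_ (sumFin-ext (ℤP.*-identityˡ ∘ x)) (ℤP.*-identityʳ (sgn b)) ⟩
  sumFin x + sgn b                        ∎

weightedSum-nb : ∀ {n} (x : Pt n) i b →
                 weightedSum (nb x i b) ≡ weightedSum x + sgn b * + suc (toℕ i)
weightedSum-nb = linear-nb (λ k → + suc (toℕ k))

-- The residue (in 1…4) of Σ xᵢ modulo 4 required on X^l_j, for the colour
-- l ∈ [2] encoded as toℕ l + 1: l if j ≤ n (flag true), l + 2 otherwise.
code : Fin 2 → Bool → ℕ
code l true = suc (toℕ l)
code l false = suc (toℕ l) ℕ.+ 2

∀-Bool? : {P : Bool → Set} → (∀ b → Dec (P b)) → Dec (∀ b → P b)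
∀-Bool? P? = map′ (λ (pf , pt) → λ { false → pf ; true → pt }) (λ p → p false , p true)
                  (P? false ×-dec P? true)

∃-Bool? : {P : Bool → Set} → (∀ b → Dec (P b)) → Dec (Σ Bool P)
∃-Bool? P? = map′ (λ { (inj₁ p) → false , p ; (inj₂ p) → true , p })
                  (λ { (false , p) → inj₁ p ; (true , p) → inj₂ p })
                  (P? false ⊎-dec P? true)

code-surjective : (r : Fin 4) → Σ (Fin 2) λ l → Σ Bool λ β → code l β ≡ suc (toℕ r)
code-surjective zero = zero , true , refl
code-surjective (suc zero) = suc zero , true , refl
code-surjective (suc (suc zero)) = zero , false , refl
code-surjective (suc (suc (suc zero))) = suc zero , false , refl

code-injective : ∀ l β l' β' → + code l β ≋ + code l' β' [mod 4 ] → l ≡ l' × β ≡ β'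
code-injective = from-yes (all? λ l → ∀-Bool? λ β → all? λ l' → ∀-Bool? λ β' →
  ≋-dec (+ code l β) (+ code l' β') 4 →-dec ((l Fin.≟ l') ×-dec (β BoolP.≟ β')))

-- A step never stays within the codes of one l: they all have the parity of l + 1.
code-parity : ∀ l β β' b → ¬ (+ code l β + sgn b ≋ + code l β' [mod 4 ])
code-parity = from-yes (all? λ l → ∀-Bool? λ β → ∀-Bool? λ β' → ∀-Bool? λ b →
  ¬? (≋-dec (+ code l β + sgn b) (+ code l β') 4))

code-step : ∀ l' β' l β → ¬ l' ≡ l →
  Σ Bool λ b → (+ code l' β' + sgn b ≋ + code l β [mod 4 ]) ×
               (∀ b' → + code l' β' + sgn b' ≋ + code l β [mod 4 ] → b' ≡ b)
code-step = from-yes (all? λ l' → ∀-Bool? λ β' → all? λ l → ∀-Bool? λ β → ¬? (l' Fin.≟ l) →-dec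
  ∃-Bool? λ b → reaches? l' β' l β b ×-dec ∀-Bool? λ b' → reaches? l' β' l β b' →-dec (b' BoolP.≟ b))
  where
  reaches? : ∀ l' β' l β b → Dec (+ code l' β' + sgn b ≋ + code l β [mod 4 ])
  reaches? l' β' l β b = ≋-dec (+ code l' β' + sgn b) (+ code l β) 4

classify : ∀ s → Σ (Fin 2) λ l → Σ Bool λ β → s ≋ + code l β [mod 4 ]
classify s =
  let (r , s≋r) = representative 3 s
      (l , β , code≡r) = code-surjective r
  in l , β , subst (λ t → s ≋ + t [mod 4 ]) (sym code≡r) s≋r

lowHalf : (n : ℕ) → Fin (2 ℕ.* n) → Bool
lowHalf n j = decided (suc (toℕ j) ℕ.≤? n)
  where
  decided : ∀ {A : Set} → Dec A → Bool
  decided (yes _) = true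
  decided (no _) = false

place : ∀ {n} → Bool → Fin n → Fin (2 ℕ.* n)
place {n} true r = r ↑ˡ (n ℕ.+ 0)
place {n} false r = n ↑ʳ (r ↑ˡ 0)

lowHalf-place : ∀ {n} β (r : Fin n) → lowHalf n (place β r) ≡ β
lowHalf-place {n} true r with suc (toℕ (r ↑ˡ (n ℕ.+ 0))) ℕ.≤? n
... | yes _ = refl
... | no r≥n = contradiction (subst (λ t → suc t ≤ n) (sym (FinP.toℕ-↑ˡ r _)) (FinP.toℕ<n r)) r≥n
lowHalf-place {n} false r with suc (toℕ (n ↑ʳ (r ↑ˡ 0))) ℕ.≤? n
... | yes n+r<n = contradiction (subst (λ t → suc t ≤ n) (FinP.toℕ-↑ʳ n _) n+r<n)
                                (ℕP.<⇒≱ (ℕ.s≤s (ℕP.m≤m+n n _)))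
... | no _ = refl

place-weight : ∀ {n} β (r : Fin n) → + suc (toℕ (place β r)) ≋ + suc (toℕ r) [mod n ]
place-weight {n} true r =
  subst (λ t → + suc t ≋ + suc (toℕ r) [mod n ]) (sym (FinP.toℕ-↑ˡ r _)) (≋-refl (+ suc (toℕ r)))
place-weight {n} false r = ≋-rewrite n+[1+r] refl (≋-+ʳ (+ suc (toℕ r)) ≋-period)
  where
  n+[1+r] : + n + + suc (toℕ r) ≡ + suc (toℕ (n ↑ʳ (r ↑ˡ 0)))
  n+[1+r] = cong +_ (trans (ℕP.+-suc n (toℕ r))
                           (cong suc (sym (trans (FinP.toℕ-↑ʳ n _) (cong (n ℕ.+_) (FinP.toℕ-↑ˡ r 0))))))

halves-injective : ∀ {n} .{{_ : NonZero n}} (j j' : Fin (2 ℕ.* n)) → lowHalf n j ≡ lowHalf n j' →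
                   + suc (toℕ j) ≋ + suc (toℕ j') [mod n ] → j ≡ j'
halves-injective {n} j j' same-half j≋j' with suc (toℕ j) ℕ.≤? n | suc (toℕ j') ℕ.≤? n
... | yes j<n | yes j'<n = FinP.toℕ-injective (ℕP.suc-injective (≋-window 0 z<s j<n z<s j'<n j≋j'))
... | no j≥n | no j'≥n = FinP.toℕ-injective (ℕP.suc-injective
  (≋-window n (ℕP.≰⇒> j≥n) (below-2n j) (ℕP.≰⇒> j'≥n) (below-2n j') j≋j'))
  where
  below-2n : (j : Fin (2 ℕ.* n)) → suc (toℕ j) ≤ n ℕ.+ n
  below-2n j = subst (λ t → suc (toℕ j) ≤ n ℕ.+ t) (ℕP.+-identityʳ n) (FinP.toℕ<n j)

InX : (n : ℕ) → Fin 2 → Fin (2 ℕ.* n) → Pt n → Set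
InX n l j x = (sumCoords x ≋ + code l (lowHalf n j) [mod 4 ]) × (weightedSum x ≋ + suc (toℕ j) [mod n ])

Xfam→InX : ∀ {n} l j x → Xfam n l j x → InX n l j x
Xfam→InX {n} l j x x∈ with suc (toℕ j) ℕ.≤? n
... | yes _ = ⟨ SD.∣ᵤ⇒∣ (proj₁ x∈) ⟩ , ⟨ SD.∣ᵤ⇒∣ (proj₂ x∈) ⟩
... | no _ = ⟨ SD.∣ᵤ⇒∣ (proj₁ x∈) ⟩ , ⟨ SD.∣ᵤ⇒∣ (proj₂ x∈) ⟩

InX→Xfam : ∀ {n} l j x → InX n l j x → Xfam n l j x
InX→Xfam {n} l j x (⟨ s≋ ⟩ , ⟨ w≋ ⟩) with suc (toℕ j) ℕ.≤? n
... | yes _ = SD.∣⇒∣ᵤ s≋ , SD.∣⇒∣ᵤ w≋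
... | no _ = SD.∣⇒∣ᵤ s≋ , SD.∣⇒∣ᵤ w≋

-- Every point lies in some X^l_j: Σ xᵢ mod 4 gives l and the half of j,
-- Σ i·xᵢ mod n gives j within that half.
InX-exists : ∀ m (x : Pt (suc m)) → Σ (Fin 2) λ l → Σ (Fin (2 ℕ.* suc m)) λ j → InX (suc m) l j x
InX-exists m x =
  let (l , β , s≋) = classify (sumCoords x)
      (r , w≋) = representative m (weightedSum x)
  in l , place β r , subst (λ β' → sumCoords x ≋ + code l β' [mod 4 ]) (sym (lowHalf-place β r)) s≋
                   , ≋-trans w≋ (≋-sym (place-weight β r))

InX-unique : ∀ {n} .{{_ : NonZero n}} {l l' j j' x} → InX n l j x → InX n l' j' x → l' ≡ l × j' ≡ j
InX-unique {j = j} {j'} (s≋ , w≋) (s≋' , w≋') =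
  let (l'≡l , half'≡half) = code-injective _ _ _ _ (≋-trans (≋-sym s≋') s≋)
  in l'≡l , halves-injective j' j half'≡half (≋-trans (≋-sym w≋') w≋)

partition : ∀ m (x : Pt (suc m)) → ∃[ l ] ∃[ j ] (Xfam (suc m) l j x ×
              (∀ l' j' → Xfam (suc m) l' j' x → l' ≡ l × j' ≡ j))
partition m x =
  let (l , j , x∈) = InX-exists m x
  in l , j , InX→Xfam l j x x∈ , λ l' j' x∈' → InX-unique {x = x} x∈ (Xfam→InX l' j' x x∈')

-- X^l is a class of Σ xᵢ modulo 2, and every step changes this parity.
no-neighbour : ∀ n l x → Union (Xfam n l) x → NoNeighbourIn (Union (Xfam n l)) x
no-neighbour n l x (j , x∈) i b (j' , y∈) =
  code-parity l (lowHalf n j) (lowHalf n j') b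
    (≋-trans (≋-+ʳ (sgn b) (≋-sym (proj₁ (Xfam→InX l j x x∈))))
             (≋-rewrite (sumCoords-nb x i b) refl (proj₁ (Xfam→InX l j' (nb x i b) y∈))))

-- If exactly one sign b moves Σ xᵢ into the class of X^l_j modulo 4, then x has
-- exactly one neighbour in X^l_j: its coordinate i is the unique solution of
-- Σ k·xₖ + b·i ≡ j (mod n).
neighbour-via-sign : ∀ m l j x b →
  let n = suc m; t = + code l (lowHalf n j) in
  sumCoords x + sgn b ≋ t [mod 4 ] → (∀ b' → sumCoords x + sgn b' ≋ t [mod 4 ] → b' ≡ b) →
  ExactlyOneNeighbourIn (Xfam n l j) x
neighbour-via-sign m l j x b reaches only-b = step (unique-solution m (sgn b) (sgn² b) w d)
  where
  n : ℕ
  n = suc m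
  w d : ℤ
  w = weightedSum x
  d = + suc (toℕ j)

  step : (Σ (Fin n) λ i → (w + sgn b * + suc (toℕ i) ≋ d [mod n ]) ×
                          (∀ i' → w + sgn b * + suc (toℕ i') ≋ d [mod n ] → i' ≡ i)) →
         ExactlyOneNeighbourIn (Xfam n l j) x
  step (i , solves , only-i) = i , b , InX→Xfam l j (nb x i b) (s-step , w-step) , unique
    where
    s-step : sumCoords (nb x i b) ≋ + code l (lowHalf n j) [mod 4 ]
    s-step = ≋-rewrite (sym (sumCoords-nb x i b)) refl reaches

    w-step : weightedSum (nb x i b) ≋ d [mod n ]
    w-step = ≋-rewrite (sym (weightedSum-nb x i b)) refl solves

    unique : ∀ i' b' → Xfam n l j (nb x i' b') → i' ≡ i × b' ≡ b
    unique i' b' y∈ = i'≡i , b'≡b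
      where
      y∈' : InX n l j (nb x i' b')
      y∈' = Xfam→InX l j (nb x i' b') y∈
      b'≡b : b' ≡ b
      b'≡b = only-b b' (≋-rewrite (sumCoords-nb x i' b') refl (proj₁ y∈'))
      i'≡i : i' ≡ i
      i'≡i = only-i i' (≋-rewrite (trans (weightedSum-nb x i' b') (cong (λ c → w + sgn c * + suc (toℕ i')) b'≡b))
                                   refl (proj₂ y∈'))

-- Off X^l, Σ xᵢ is congruent to a code of the other colour, from which exactly
-- one step reaches the code of X^l_j.
exactly-one : ∀ m l j x → ¬ Union (Xfam (suc m) l) x → ExactlyOneNeighbourIn (Xfam (suc m) l j) x
exactly-one m l j x x∉ = from-class (InX-exists m x)
  where
  n : ℕ
  n = suc m
  target : ℤ
  target = + code l (lowHalf n j)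

  -- The witnesses are destructured by local functions, which keeps them as
  -- variables instead of projections the type checker would try to unfold.

  from-class : (Σ (Fin 2) λ l₀ → Σ (Fin (2 ℕ.* n)) λ j₀ → InX n l₀ j₀ x) → ExactlyOneNeighbourIn (Xfam n l j) x
  from-class (l₀ , j₀ , x∈₀) = from-sign (code-step l₀ (lowHalf n j₀) l (lowHalf n j) l₀≢l)
    where
    c₀ : ℤ
    c₀ = + code l₀ (lowHalf n j₀)

    l₀≢l : ¬ l₀ ≡ l
    l₀≢l refl = x∉ (j₀ , InX→Xfam l₀ j₀ x x∈₀)

    from-sign : (Σ Bool λ b → (c₀ + sgn b ≋ target [mod 4 ]) × (∀ b' → c₀ + sgn b' ≋ target [mod 4 ] → b' ≡ b)) →
                ExactlyOneNeighbourIn (Xfam n l j) x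
    from-sign (b , reaches , only-b) =
      neighbour-via-sign m l j x b (≋-trans (≋-+ʳ (sgn b) (proj₁ x∈₀)) reaches)
        (λ b' reaches' → only-b b' (≋-trans (≋-+ʳ (sgn b') (≋-sym (proj₁ x∈₀))) reaches'))

lemma3p3 : (n : ℕ) → n ≥ 1 → IsFilling n n 2 (Xfam n)
lemma3p3 (suc m) _ =
  two-classes , partition m , λ l j x → exactly-one m l j x , no-neighbour (suc m) l x
  where
  two-classes : 2 ℕ.* suc m ≡ suc m ℕ.+ suc m
  two-classes = cong (suc m ℕ.+_) (ℕP.+-identityʳ (suc m))
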